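{- Define $\Phi:\mathcal P(\mathcal P(\mathcal T))\to\mathcal P(\mathbf E)$ by $\Phi(K):=\{E(\mathcal W):\mathcal W\subseteq K\}$ and $\Delta:\mathcal P(\mathbf E)\to\mathcal P(\mathcal P(\mathcal T))$ by $\Delta(\mathcal F):=\{S\subseteq\mathcal T:\overline{\mathbf D}_S\in\mathcal F\}$. Then for all SDSes $K,K_1,K_2\subseteq\mathcal P(\mathcal T)$ and all $\mathcal F,\mathcal F_1,\mathcal F_2\subseteq\mathbf E$: (i) if $K$ is a coherent SDS then $\Phi(K)$ is a proper principal filter on $(\mathbf E,\subseteq)$; (ii) if $\mathcal F$ is a proper principal filter on $(\mathbf E,\subseteq)$ then $\Delta(\mathcal F)$ is a coherent SDS; (iii) if $K$ is a coherent SDS then $\Delta(\Phi(K))=K$; (iv) if $\mathcal F$ is a proper principal filter on $(\mathbf E,\subseteq)$ then $\Phi(\Delta(\mathcal F))=\mathcal F$; (v) if $K_1\subseteq K_2$ then $\Phi(K_1)\subseteq\Phi(K_2)$; (vi) if $\mathcal F_1\subseteq\mathcal F_2$ then $\Delta(\mathcal F_1)\subseteq\Delta(\mathcal F_2)$; (vii) $\Phi(\{S\subseteq\mathcal T:S\cap\mathcal T_+\neq\emptyset\})=\{\overline{\mathbf D}\}$ and $\Phi(\mathcal P(\mathcal T))=\mathbf E$; (viii) $\Delta(\{\overline{\mathbf D}\})=\{S\subseteq\mathcal T:S\cap\mathcal T_+\neq\emptyset\}$ and $\Delta(\mathbf E)=\mathcal P(\mathcal T)$. Hence $\Phi$ is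 an order isomorphism between $(\mathbf K,\subseteq)$, where $\mathbf K$ is the set of all coherent SDSes together with $\mathcal P(\mathcal T)$, and the set $(\mathbf P(\mathbf E),\subseteq)$ of all principal filters on $\mathbf E$, with inverse $\Delta$.
   Context: Let $\mathcal T$ be a non-empty set (of "things"), $\mathrm{cl}:\mathcal P(\mathcal T)\to\mathcal P(\mathcal T)$ a closure operator (extensive, monotone, idempotent), $\mathcal T_-\subseteq\mathcal T$ a set of forbidden things, $\mathcal T_+:=\mathrm{cl}(\emptyset)$, with standing assumption $\mathcal T_+\cap\mathcal T_-=\emptyset$. A coherent SDT is a $D\subseteq\mathcal T$ with $\mathrm{cl}(D)=D$ and $D\cap\mathcal T_-=\emptyset$; $\overline{\mathbf D}$ is the set of all coherent SDTs. For $\mathcal W\subseteq\mathcal P(\mathcal T)$, $\Sigma_{\mathcal W}$ is the set of maps $\sigma:\mathcal W\to\mathcal T$ with $\sigma(S)\in S$ for all $S\in\mathcal W$, and $\sigma(\mathcal W):=\{\sigma(S):S\in\mathcal W\}$. An SDS is any $K\subseteq\mathcal P(\mathcal T)$. It is coherent if (K1) $\emptyset\notin K$; (K2) if $S_1\in K$ and $S_1\subseteq S_2\subseteq\mathcal T$ then $S_2\in K$; (K3) if $S\in K$ then $S\setminus\mathcal T_-\in K$; (K4) $\{t\}\in K$ for all $t\in\mathcal T_+$; (K5) for every non-empty $\mathcal W\subseteq K$ and every family $(t_\sigma)_{\sigma\in\Sigma_{\mathcal W}}$ with $t_\sigma\in\mathrm{cl}(\sigma(\mathcal W))$, $\{t_\sigma:\sigma\in\Sigma_{\mathcal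 W}\}\in K$. For $S\subseteq\mathcal T$ let $\overline{\mathbf D}_S:=\{D\in\overline{\mathbf D}:S\cap D\neq\emptyset\}$, for $\mathcal W\subseteq\mathcal P(\mathcal T)$ let $E(\mathcal W):=\bigcap_{S\in\mathcal W}\overline{\mathbf D}_S$ (with $E(\emptyset)=\overline{\mathbf D}$), and $\mathbf E:=\{E(\mathcal W):\mathcal W\subseteq\mathcal P(\mathcal T)\}$, ordered by inclusion (a complete lattice with intersection as meet, union as join, bottom $\emptyset$, top $\overline{\mathbf D}$). A principal filter on $\mathbf E$ is a set of the form $\{E'\in\mathbf E:E(\mathcal W)\subseteq E'\}$ for some $\mathcal W\subseteq\mathcal P(\mathcal T)$; it is proper if it is not all of $\mathbf E$, i.e. if $E(\mathcal W)\neq\emptyset$. -}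

module Defs where

open import Level using (0ℓ)
open import Axiom.ExcludedMiddle using (ExcludedMiddle)
open import Data.Bool using (Bool; true; false; _∧_; not)
open import Data.Product using (Σ; _×_; _,_; ∃)
open import Data.Sum using (_⊎_)
open import Data.Empty using (⊥)
open import Relation.Nullary using (¬_; does)
open import Relation.Binary.PropositionalEquality using (_≡_)

-- Sets are classical: a subset of a type A is its characteristic
-- function A → Bool.  Comprehension {x ∣ P x} is formed with the
-- excluded-middle oracle.

module _ {A : Set} where
  _∈_ : A → (A → Bool) → Set
  x ∈ P = P x ≡ true

  _⊆_ : (A → Bool) → (A → Bool) → Set
  P ⊆ Q = ∀ x → x ∈ P → x ∈ Q

  _≐_ : (A → Bool) → (A → Bool) → Set
  P ≐ Q = P ⊆ Q × Q ⊆ P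

  ∅ : A → Bool
  ∅ _ = false

  full : A → Bool
  full _ = true

  _∩_ : (A → Bool) → (A → Bool) → A → Bool
  (P ∩ Q) x = P x ∧ Q x

  _∖_ : (A → Bool) → (A → Bool) → A → Bool
  (P ∖ Q) x = P x ∧ not (Q x)

  NonEmpty : (A → Bool) → Set
  NonEmpty P = ∃ λ x → x ∈ P

  infix 4 _∈_ _⊆_ _≐_

record IsClosure {T : Set} (cl : (T → Bool) → (T → Bool)) : Set where
  field
    extensive  : ∀ A → A ⊆ cl A
    monotone   : ∀ A B → A ⊆ B → cl A ⊆ cl B
    idempotent : ∀ A → cl (cl A) ≐ cl A

module Theory (em : ExcludedMiddle 0ℓ) (T : Set)
              (cl : (T → Bool) → (T → Bool)) (T₋ : T → Bool) where

  ⟪_⟫ : {A : Set} → (A → Set) → A → Bool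
  ⟪ P ⟫ x = does (em {P x})

  Sub : Set
  Sub = T → Bool

  Coll : Set
  Coll = Sub → Bool

  FamSet : Set
  FamSet = Coll → Bool

  T₊ : Sub
  T₊ = cl ∅

  ｛_｝ : T → Sub
  ｛ t ｝ = ⟪ (λ t' → t' ≡ t) ⟫

  IsCoherentSDT : Sub → Set
  IsCoherentSDT D = cl D ≐ D × (D ∩ T₋) ≐ ∅

  𝐃̄ : Coll
  𝐃̄ = ⟪ IsCoherentSDT ⟫

  𝐃̄[_] : Sub → Coll
  𝐃̄[ S ] = ⟪ (λ D → D ∈ 𝐃̄ × NonEmpty (S ∩ D)) ⟫

  E : Coll → Coll
  E W = ⟪ (λ D → D ∈ 𝐃̄ × (∀ S → S ∈ W → D ∈ 𝐃̄[ S ])) ⟫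

  𝐄 : FamSet
  𝐄 = ⟪ (λ X → Σ Coll (λ W → X ≐ E W)) ⟫

  IsPrincipalFilter : FamSet → Set
  IsPrincipalFilter 𝓕 =
    Σ Coll (λ W → 𝓕 ≐ ⟪ (λ X → X ∈ 𝐄 × E W ⊆ X) ⟫)

  IsProperPrincipalFilter : FamSet → Set
  IsProperPrincipalFilter 𝓕 = IsPrincipalFilter 𝓕 × ¬ (𝓕 ≐ 𝐄)

  ChoiceFn : Coll → Set
  ChoiceFn W = Σ ((S : Sub) → S ∈ W → T) (λ σ → ∀ S (p : S ∈ W) → σ S p ∈ S)

  image : (W : Coll) → ChoiceFn W → Sub
  image W (σ , _) = ⟪ (λ t → Σ Sub (λ S → Σ (S ∈ W) (λ p → σ S p ≡ t))) ⟫

  record IsCoherentSDS (K : Coll) : Set where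
    field
      K1 : ¬ (∅ ∈ K)
      K2 : ∀ S₁ S₂ → S₁ ∈ K → S₁ ⊆ S₂ → S₂ ∈ K
      K3 : ∀ S → S ∈ K → (S ∖ T₋) ∈ K
      K4 : ∀ t → t ∈ T₊ → ｛ t ｝ ∈ K
      K5 : ∀ (W : Coll) → NonEmpty W → W ⊆ K →
           (tσ : ChoiceFn W → T) → (∀ σ → tσ σ ∈ cl (image W σ)) →
           ⟪ (λ t → Σ (ChoiceFn W) (λ σ → tσ σ ≡ t)) ⟫ ∈ K

  Φ : Coll → FamSet
  Φ K = ⟪ (λ X → Σ Coll (λ W → W ⊆ K × X ≐ E W)) ⟫

  Δ : FamSet → Coll
  Δ 𝓕 S = 𝓕 𝐃̄[ S ]

  K₊ : Coll
  K₊ = ⟪ (λ S → NonEmpty (S ∩ T₊)) ⟫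

  ｛𝐃̄｝ : FamSet
  ｛𝐃̄｝ = ⟪ (λ X → X ≐ 𝐃̄) ⟫

  In𝐊 : Coll → Set
  In𝐊 K = IsCoherentSDS K ⊎ K ≐ full

  Theorem8 : Set
  Theorem8 =
      (∀ K → IsCoherentSDS K → IsProperPrincipalFilter (Φ K))
    × (∀ 𝓕 → IsProperPrincipalFilter 𝓕 → IsCoherentSDS (Δ 𝓕))
    × (∀ K → IsCoherentSDS K → Δ (Φ K) ≐ K)
    × (∀ 𝓕 → IsProperPrincipalFilter 𝓕 → Φ (Δ 𝓕) ≐ 𝓕)
    × (∀ K₁ K₂ → K₁ ⊆ K₂ → Φ K₁ ⊆ Φ K₂)
    × (∀ 𝓕₁ 𝓕₂ → 𝓕₁ ⊆ 𝓕₂ → Δ 𝓕₁ ⊆ Δ 𝓕₂)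
    × (Φ K₊ ≐ ｛𝐃̄｝ × Φ full ≐ 𝐄)
    × (Δ ｛𝐃̄｝ ≐ K₊ × Δ 𝐄 ≐ full)
    × ( (∀ K → In𝐊 K → IsPrincipalFilter (Φ K))
      × (∀ 𝓕 → IsPrincipalFilter 𝓕 → In𝐊 (Δ 𝓕))
      × (∀ K → In𝐊 K → Δ (Φ K) ≐ K)
      × (∀ 𝓕 → IsPrincipalFilter 𝓕 → Φ (Δ 𝓕) ≐ 𝓕)
      × (∀ K₁ K₂ → In𝐊 K₁ → In𝐊 K₂ → (K₁ ⊆ K₂ → Φ K₁ ⊆ Φ K₂) × (Φ K₁ ⊆ Φ K₂ → K₁ ⊆ K₂)))

-- Everything rests on one fact: a coherent SDS K is closed under entailment, i.e. if every
-- coherent SDT meeting all sets of some W ⊆ K also meets S, then S ∈ K.  For non-empty W,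
-- any choice function σ on W yields t_σ ∈ cl σ(W) lying in S or in T₋ (otherwise cl σ(W)
-- would be a coherent SDT meeting W but not S); K5 collects these t_σ into a member of K,
-- K3 removes T₋ from it and K2 enlarges the rest to S.  Since 𝐃̄_S = E {S}, closure under
-- entailment makes Φ K the principal filter generated by E K and gives Δ (Φ K) = K.
-- Conversely, for a principal filter generated by E W₀, Δ is {S ∣ E W₀ ⊆ 𝐃̄_S}, which
-- satisfies K1–K5 (K1 exactly when E W₀ ≠ ∅), and Φ (Δ 𝓕) = 𝓕.
module Submission where

open import Defs
open import Level using (0ℓ)
open import Axiom.ExcludedMiddle using (ExcludedMiddle)
open import Data.Bool using (Bool; true; false; _∧_; not)
open import Data.Bool.Properties using (∧-conicalˡ; ∧-conicalʳ)
open import Data.Product using (Σ; _×_; _,_; proj₁; proj₂)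
open import Data.Sum using (_⊎_; inj₁; inj₂)
open import Data.Empty using (⊥-elim)
open import Relation.Nullary using (¬_; yes; no)
open import Relation.Nullary.Decidable using (dec-true; decidable-stable)
open import Relation.Binary.PropositionalEquality using (_≡_; refl; sym; subst)

∧-intro : ∀ {a b} → a ≡ true → b ≡ true → a ∧ b ≡ true
∧-intro refl b = b

∧-not-intro : ∀ {a b} → a ≡ true → ¬ b ≡ true → a ∧ not b ≡ true
∧-not-intro {b = false} refl _ = refl
∧-not-intro {b = true}  refl n = ⊥-elim (n refl)

module _ {A : Set} where

  ⊆-refl : {P : A → Bool} → P ⊆ P
  ⊆-refl _ p = p

  ⊆-trans : {P Q R : A → Bool} → P ⊆ Q → Q ⊆ R → P ⊆ R
  ⊆-trans P⊆Q Q⊆R x p = Q⊆R x (P⊆Q x p)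

  ≐-sym : {P Q : A → Bool} → P ≐ Q → Q ≐ P
  ≐-sym (P⊆Q , Q⊆P) = Q⊆P , P⊆Q

  ≐-trans : {P Q R : A → Bool} → P ≐ Q → Q ≐ R → P ≐ R
  ≐-trans (P⊆Q , Q⊆P) (Q⊆R , R⊆Q) = ⊆-trans P⊆Q Q⊆R , ⊆-trans R⊆Q Q⊆P

  ∩⁻ : (P Q : A → Bool) (x : A) → x ∈ P ∩ Q → x ∈ P × x ∈ Q
  ∩⁻ P Q x r = ∧-conicalˡ (P x) (Q x) r , ∧-conicalʳ (P x) (Q x) r

  ∖⁻ : (P Q : A → Bool) (x : A) → x ∈ P ∖ Q → x ∈ P × ¬ x ∈ Q
  ∖⁻ P Q x r with P x | Q x
  ∖⁻ P Q x r  | true  | false = refl , λ ()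
  ∖⁻ P Q x () | true  | true
  ∖⁻ P Q x () | false | _

module SDSFilterCorrespondence (em : ExcludedMiddle 0ℓ) (T : Set)
                               (cl : (T → Bool) → (T → Bool)) (isClosure : IsClosure cl)
                               (T₋ : T → Bool) (T₊∩T₋≐∅ : (cl ∅ ∩ T₋) ≐ ∅) where
  open Theory em T cl T₋
  open IsClosure isClosure

  -- The predicate P is always passed explicitly: x ∈ ⟪ P ⟫ unfolds to does (em {P x}),
  -- from which Agda cannot recover P.
  ⟪⟫⁺ : {A : Set} (P : A → Set) {x : A} → P x → x ∈ ⟪ P ⟫
  ⟪⟫⁺ P {x} = dec-true (em {P x})

  ⟪⟫⁻ : {A : Set} (P : A → Set) {x : A} → x ∈ ⟪ P ⟫ → P x
  ⟪⟫⁻ P {x} q with em {P x}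
  ... | yes p = p
  ⟪⟫⁻ P () | no _

  𝐃̄⁺ : ∀ {D} → IsCoherentSDT D → D ∈ 𝐃̄
  𝐃̄⁺ = ⟪⟫⁺ IsCoherentSDT

  𝐃̄⁻ : ∀ {D} → D ∈ 𝐃̄ → IsCoherentSDT D
  𝐃̄⁻ = ⟪⟫⁻ IsCoherentSDT

  𝐃̄[]⁺ : ∀ {S D} t → D ∈ 𝐃̄ → t ∈ S → t ∈ D → D ∈ 𝐃̄[ S ]
  𝐃̄[]⁺ {S} t d t∈S t∈D = ⟪⟫⁺ (λ D → D ∈ 𝐃̄ × NonEmpty (S ∩ D)) (d , t , ∧-intro t∈S t∈D)

  𝐃̄[]⁻ : ∀ S {D} → D ∈ 𝐃̄[ S ] → D ∈ 𝐃̄ × Σ T (λ t → t ∈ S × t ∈ D)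
  𝐃̄[]⁻ S {D} d with ⟪⟫⁻ (λ D → D ∈ 𝐃̄ × NonEmpty (S ∩ D)) d
  ... | d∈𝐃̄ , t , t∈S∩D = d∈𝐃̄ , t , ∩⁻ S D t t∈S∩D

  K₊⁺ : ∀ {S t} → t ∈ S → t ∈ T₊ → S ∈ K₊
  K₊⁺ {S} {t} t∈S t∈T₊ = ⟪⟫⁺ (λ S → NonEmpty (S ∩ T₊)) (t , ∧-intro t∈S t∈T₊)

  K₊⁻ : ∀ {S} → S ∈ K₊ → Σ T (λ t → t ∈ S × t ∈ T₊)
  K₊⁻ {S} S∈K₊ with ⟪⟫⁻ (λ S → NonEmpty (S ∩ T₊)) S∈K₊
  ... | t , t∈S∩T₊ = t , ∩⁻ S T₊ t t∈S∩T₊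

  E⁺ : ∀ {W D} → D ∈ 𝐃̄ → (∀ S → S ∈ W → D ∈ 𝐃̄[ S ]) → D ∈ E W
  E⁺ {W} d h = ⟪⟫⁺ (λ D → D ∈ 𝐃̄ × (∀ S → S ∈ W → D ∈ 𝐃̄[ S ])) (d , h)

  E⁻ : ∀ {W D} → D ∈ E W → D ∈ 𝐃̄ × (∀ S → S ∈ W → D ∈ 𝐃̄[ S ])
  E⁻ {W} = ⟪⟫⁻ (λ D → D ∈ 𝐃̄ × (∀ S → S ∈ W → D ∈ 𝐃̄[ S ]))

  𝐄⁺ : ∀ {X} W → X ≐ E W → X ∈ 𝐄
  𝐄⁺ W e = ⟪⟫⁺ (λ X → Σ Coll (λ W → X ≐ E W)) (W , e)

  𝐄⁻ : ∀ {X} → X ∈ 𝐄 → Σ Coll (λ W → X ≐ E W)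
  𝐄⁻ = ⟪⟫⁻ (λ X → Σ Coll (λ W → X ≐ E W))

  Φ⁺ : ∀ {K X} W → W ⊆ K → X ≐ E W → X ∈ Φ K
  Φ⁺ {K} W W⊆K e = ⟪⟫⁺ (λ X → Σ Coll (λ W → W ⊆ K × X ≐ E W)) (W , W⊆K , e)

  Φ⁻ : ∀ {K X} → X ∈ Φ K → Σ Coll (λ W → W ⊆ K × X ≐ E W)
  Φ⁻ {K} = ⟪⟫⁻ (λ X → Σ Coll (λ W → W ⊆ K × X ≐ E W))

  ↑_ : Coll → FamSet
  ↑ W = ⟪ (λ X → X ∈ 𝐄 × E W ⊆ X) ⟫

  ↑⁺ : ∀ {W X} → X ∈ 𝐄 → E W ⊆ X → X ∈ ↑ W
  ↑⁺ {W} x h = ⟪⟫⁺ (λ X → X ∈ 𝐄 × E W ⊆ X) (x , h)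

  ↑⁻ : ∀ {W X} → X ∈ ↑ W → X ∈ 𝐄 × E W ⊆ X
  ↑⁻ {W} = ⟪⟫⁻ (λ X → X ∈ 𝐄 × E W ⊆ X)

  singleton : Sub → Coll
  singleton S = ⟪ (λ S′ → S′ ≡ S) ⟫

  range : {A : Set} → (A → T) → Sub
  range {A} f = ⟪ (λ t → Σ A (λ a → f a ≡ t)) ⟫

  range⁺ : ∀ {A} (f : A → T) a → f a ∈ range f
  range⁺ {A} f a = ⟪⟫⁺ (λ t → Σ A (λ a → f a ≡ t)) (a , refl)

  singleton⁺ : ∀ S → S ∈ singleton S
  singleton⁺ S = ⟪⟫⁺ (_≡ S) refl

  singleton⁻ : ∀ {S S′} → S′ ∈ singleton S → S′ ≡ S
  singleton⁻ {S} = ⟪⟫⁻ (_≡ S)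

  range⁻ : ∀ {A} {f : A → T} {t} → t ∈ range f → Σ A (λ a → f a ≡ t)
  range⁻ {A} {f} = ⟪⟫⁻ (λ t → Σ A (λ a → f a ≡ t))

  image⁺ : ∀ {W} (σ : ChoiceFn W) S (S∈W : S ∈ W) → proj₁ σ S S∈W ∈ image W σ
  image⁺ {W} σ S S∈W = ⟪⟫⁺ (λ t → Σ Sub (λ S → Σ (S ∈ W) (λ p → proj₁ σ S p ≡ t))) (S , S∈W , refl)

  image⁻ : ∀ {W σ t} → t ∈ image W σ → Σ Sub (λ S → Σ (S ∈ W) (λ p → proj₁ σ S p ≡ t))
  image⁻ {W} {σ} = ⟪⟫⁻ (λ t → Σ Sub (λ S → Σ (S ∈ W) (λ p → proj₁ σ S p ≡ t)))

  coherent-avoids-T₋ : ∀ {D t} → D ∈ 𝐃̄ → t ∈ D → ¬ t ∈ T₋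
  coherent-avoids-T₋ {t = t} d t∈D t∈T₋ with proj₁ (proj₂ (𝐃̄⁻ d)) t (∧-intro t∈D t∈T₋)
  ... | ()

  T₊⊆coherent : ∀ {D} → D ∈ 𝐃̄ → T₊ ⊆ D
  T₊⊆coherent {D} d = ⊆-trans (monotone ∅ D λ _ ()) (proj₁ (proj₁ (𝐃̄⁻ d)))

  T₊∈𝐃̄ : T₊ ∈ 𝐃̄
  T₊∈𝐃̄ = 𝐃̄⁺ (idempotent ∅ , T₊∩T₋≐∅)

  cl-coherent : ∀ {A} → (∀ t → t ∈ cl A → ¬ t ∈ T₋) → cl A ∈ 𝐃̄
  cl-coherent {A} avoids = 𝐃̄⁺ (idempotent A , disjoint , λ _ ())
    where
      disjoint : (cl A ∩ T₋) ⊆ ∅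
      disjoint t p = let (t∈clA , t∈T₋) = ∩⁻ (cl A) T₋ t p in ⊥-elim (avoids t t∈clA t∈T₋)

  𝐃̄[]⊆𝐃̄ : ∀ {S} → 𝐃̄[ S ] ⊆ 𝐃̄
  𝐃̄[]⊆𝐃̄ {S} D d = proj₁ (𝐃̄[]⁻ S d)

  ∉𝐃̄[∅] : ∀ D → ¬ D ∈ 𝐃̄[ ∅ ]
  ∉𝐃̄[∅] D d with 𝐃̄[]⁻ ∅ d
  ... | _ , _ , () , _

  𝐃̄[]-mono : ∀ {S₁ S₂} → S₁ ⊆ S₂ → 𝐃̄[ S₁ ] ⊆ 𝐃̄[ S₂ ]
  𝐃̄[]-mono {S₁} S₁⊆S₂ D d with 𝐃̄[]⁻ S₁ d
  ... | d∈𝐃̄ , t , t∈S₁ , t∈D = 𝐃̄[]⁺ t d∈𝐃̄ (S₁⊆S₂ t t∈S₁) t∈D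

  𝐃̄[]⊆𝐃̄[∖T₋] : ∀ {S} → 𝐃̄[ S ] ⊆ 𝐃̄[ S ∖ T₋ ]
  𝐃̄[]⊆𝐃̄[∖T₋] {S} D d with 𝐃̄[]⁻ S d
  ... | d∈𝐃̄ , t , t∈S , t∈D = 𝐃̄[]⁺ t d∈𝐃̄ (∧-not-intro t∈S (coherent-avoids-T₋ d∈𝐃̄ t∈D)) t∈D

  𝐃̄⊆𝐃̄[] : ∀ {S t} → t ∈ S → t ∈ T₊ → 𝐃̄ ⊆ 𝐃̄[ S ]
  𝐃̄⊆𝐃̄[] {t = t} t∈S t∈T₊ D d = 𝐃̄[]⁺ t d t∈S (T₊⊆coherent d t t∈T₊)

  E⊆𝐃̄ : ∀ {W} → E W ⊆ 𝐃̄
  E⊆𝐃̄ D d = proj₁ (E⁻ d)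

  E⊆𝐃̄[] : ∀ {W S} → S ∈ W → E W ⊆ 𝐃̄[ S ]
  E⊆𝐃̄[] S∈W D d = proj₂ (E⁻ d) _ S∈W

  E-antitone : ∀ {W W′} → W ⊆ W′ → E W′ ⊆ E W
  E-antitone W⊆W′ D d = E⁺ (proj₁ (E⁻ d)) λ S S∈W → proj₂ (E⁻ d) S (W⊆W′ S S∈W)

  E-generators : ∀ {W₀ W} → (∀ S → S ∈ W → E W₀ ⊆ 𝐃̄[ S ]) → E W₀ ⊆ E W
  E-generators h D d = E⁺ (proj₁ (E⁻ d)) λ S S∈W → h S S∈W D d

  𝐃̄[]≐E-singleton : ∀ S → 𝐃̄[ S ] ≐ E (singleton S)
  𝐃̄[]≐E-singleton S =
      (λ D d → E⁺ (𝐃̄[]⊆𝐃̄ D d) λ S′ S′≡S → subst (λ Z → D ∈ 𝐃̄[ Z ]) (sym (singleton⁻ S′≡S)) d)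
    , E⊆𝐃̄[] (singleton⁺ S)

  𝐃̄[]∈𝐄 : ∀ S → 𝐃̄[ S ] ∈ 𝐄
  𝐃̄[]∈𝐄 S = 𝐄⁺ (singleton S) (𝐃̄[]≐E-singleton S)

  E-meeting-T₊ : ∀ {W} → W ⊆ K₊ → E W ≐ 𝐃̄
  E-meeting-T₊ W⊆K₊ = E⊆𝐃̄ , λ D d → E⁺ d λ S S∈W →
    let (_ , t∈S , t∈T₊) = K₊⁻ (W⊆K₊ S S∈W) in 𝐃̄⊆𝐃̄[] t∈S t∈T₊ D d

  E⁺-choice : ∀ {W D} (σ : ChoiceFn W) → D ∈ 𝐃̄ → image W σ ⊆ D → D ∈ E W
  E⁺-choice σ d σW⊆D = E⁺ d λ S S∈W →
    𝐃̄[]⁺ (proj₁ σ S S∈W) d (proj₂ σ S S∈W) (σW⊆D _ (image⁺ σ S S∈W))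

  E⁻-choice : ∀ {W D} → D ∈ E W → Σ (ChoiceFn W) (λ σ → image W σ ⊆ D)
  E⁻-choice {W} {D} d = (pick , picked) , σW⊆D
    where
      meets : ∀ S → S ∈ W → Σ T (λ t → t ∈ S × t ∈ D)
      meets S S∈W = proj₂ (𝐃̄[]⁻ S (proj₂ (E⁻ d) S S∈W))
      pick : (S : Sub) → S ∈ W → T
      pick S S∈W = proj₁ (meets S S∈W)
      picked : ∀ S (S∈W : S ∈ W) → pick S S∈W ∈ S
      picked S S∈W = proj₁ (proj₂ (meets S S∈W))
      σW⊆D : image W (pick , picked) ⊆ D
      σW⊆D t t∈σW with image⁻ {W} {pick , picked} t∈σW
      ... | S , S∈W , refl = proj₂ (proj₂ (meets S S∈W))

  E⊆𝐃̄[range] : ∀ {W} (tσ : ChoiceFn W → T) → (∀ σ → tσ σ ∈ cl (image W σ)) →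
                E W ⊆ 𝐃̄[ range tσ ]
  E⊆𝐃̄[range] tσ tσ∈cl D d with E⁻-choice d
  ... | σ , σW⊆D = 𝐃̄[]⁺ (tσ σ) d∈𝐃̄ (range⁺ tσ σ) tσ∈D
    where
      d∈𝐃̄ = proj₁ (E⁻ d)
      tσ∈D : tσ σ ∈ D
      tσ∈D = proj₁ (proj₁ (𝐃̄⁻ d∈𝐃̄)) _ (monotone _ D σW⊆D _ (tσ∈cl σ))

  -- Otherwise cl σ(W) would be a coherent SDT in E W not meeting S.
  cl-image-meets : ∀ {W S} → E W ⊆ 𝐃̄[ S ] → (σ : ChoiceFn W) →
                   Σ T (λ t → t ∈ cl (image W σ) × (t ∈ S ⊎ t ∈ T₋))
  cl-image-meets {W} {S} E⊆ σ = decidable-stable em λ none →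
    let D∈𝐃̄ = cl-coherent λ t t∈D t∈T₋ → none (t , t∈D , inj₂ t∈T₋)
        (_ , t , t∈S , t∈D) = 𝐃̄[]⁻ S (E⊆ _ (E⁺-choice σ D∈𝐃̄ (extensive (image W σ))))
    in none (t , t∈D , inj₁ t∈S)

  range∖T₋⊆ : ∀ {A} {f : A → T} {S} → (∀ a → f a ∈ S ⊎ f a ∈ T₋) → (range f ∖ T₋) ⊆ S
  range∖T₋⊆ {f = f} h t t∈U∖T₋ with ∖⁻ (range f) T₋ t t∈U∖T₋
  ... | t∈U , t∉T₋ with range⁻ {f = f} {t} t∈U
  ... | a , refl with h a
  ... | inj₁ t∈S = t∈S
  ... | inj₂ t∈T₋ = ⊥-elim (t∉T₋ t∈T₋)

  EntailmentClosed : Coll → Set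
  EntailmentClosed K = ∀ W S → W ⊆ K → E W ⊆ 𝐃̄[ S ] → S ∈ K

  module _ {K : Coll} (coherent : IsCoherentSDS K) where
    open IsCoherentSDS coherent

    meets-T₊⇒∈ : ∀ {S t} → t ∈ S → t ∈ T₊ → S ∈ K
    meets-T₊⇒∈ {S} {t} t∈S t∈T₊ =
      K2 ｛ t ｝ S (K4 t t∈T₊) λ x x≡t → subst (_∈ S) (sym (⟪⟫⁻ (_≡ t) x≡t)) t∈S

    coherent⇒entailment-closed : EntailmentClosed K
    coherent⇒entailment-closed W S W⊆K E⊆ with em {NonEmpty W}
    ... | no W-empty = let (_ , _ , t∈S , t∈T₊) = 𝐃̄[]⁻ S (E⊆ T₊ T₊∈E) in meets-T₊⇒∈ t∈S t∈T₊
      where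
        T₊∈E : T₊ ∈ E W
        T₊∈E = E⁺ T₊∈𝐃̄ λ S′ S′∈W → ⊥-elim (W-empty (S′ , S′∈W))
    ... | yes W-nonempty = K2 (range tσ ∖ T₋) S (K3 _ (K5 W W-nonempty W⊆K tσ tσ∈cl))
                             (range∖T₋⊆ λ σ → proj₂ (proj₂ (cl-image-meets E⊆ σ)))
      where
        tσ : ChoiceFn W → T
        tσ σ = proj₁ (cl-image-meets E⊆ σ)
        tσ∈cl : ∀ σ → tσ σ ∈ cl (image W σ)
        tσ∈cl σ = proj₁ (proj₂ (cl-image-meets E⊆ σ))

  𝐊⇒entailment-closed : ∀ {K} → In𝐊 K → EntailmentClosed K
  𝐊⇒entailment-closed (inj₁ coherent) = coherent⇒entailment-closed coherent
  𝐊⇒entailment-closed (inj₂ K≐full) _ S _ _ = proj₂ K≐full S refl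

  ↑⁻-generators : ∀ {W₀ X} → X ∈ ↑ W₀ →
                  Σ Coll (λ W → X ≐ E W × (∀ S → S ∈ W → E W₀ ⊆ 𝐃̄[ S ]))
  ↑⁻-generators x with ↑⁻ x
  ... | X∈𝐄 , E⊆X with 𝐄⁻ X∈𝐄
  ... | W , X≐EW = W , X≐EW , λ S S∈W → ⊆-trans E⊆X (⊆-trans (proj₁ X≐EW) (E⊆𝐃̄[] S∈W))

  Φ⊆↑ : ∀ {K} → Φ K ⊆ ↑ K
  Φ⊆↑ X x with Φ⁻ x
  ... | W , W⊆K , X≐EW = ↑⁺ (𝐄⁺ W X≐EW) (⊆-trans (E-antitone W⊆K) (proj₂ X≐EW))

  Φ≐↑ : ∀ {K} → EntailmentClosed K → Φ K ≐ ↑ K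
  Φ≐↑ {K} closed = Φ⊆↑ , λ X x →
    let (W , X≐EW , entailed) = ↑⁻-generators x
    in Φ⁺ W (λ S S∈W → closed K S ⊆-refl (entailed S S∈W)) X≐EW

  Φ-mono : ∀ {K₁ K₂} → K₁ ⊆ K₂ → Φ K₁ ⊆ Φ K₂
  Φ-mono K₁⊆K₂ X x with Φ⁻ x
  ... | W , W⊆K₁ , X≐EW = Φ⁺ W (⊆-trans W⊆K₁ K₁⊆K₂) X≐EW

  Δ-mono : ∀ {𝓕₁ 𝓕₂} → 𝓕₁ ⊆ 𝓕₂ → Δ 𝓕₁ ⊆ Δ 𝓕₂
  Δ-mono 𝓕₁⊆𝓕₂ S = 𝓕₁⊆𝓕₂ 𝐃̄[ S ]

  Δ∘Φ : ∀ {K} → EntailmentClosed K → Δ (Φ K) ≐ K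
  Δ∘Φ {K} closed = (λ S S∈ΔΦ → let (W , W⊆K , e) = Φ⁻ S∈ΔΦ in closed W S W⊆K (proj₂ e))
             , λ S S∈K → Φ⁺ (singleton S) (λ S′ S′≡S → subst (_∈ K) (sym (singleton⁻ S′≡S)) S∈K)
                            (𝐃̄[]≐E-singleton S)

  Φ-reflects-⊆ : ∀ {K₁ K₂} → EntailmentClosed K₁ → EntailmentClosed K₂ → Φ K₁ ⊆ Φ K₂ → K₁ ⊆ K₂
  Φ-reflects-⊆ closed₁ closed₂ Φ⊆Φ =
    ⊆-trans (proj₂ (Δ∘Φ closed₁)) (⊆-trans (Δ-mono Φ⊆Φ) (proj₁ (Δ∘Φ closed₂)))

  Φ-proper : ∀ {K} → IsCoherentSDS K → ¬ Φ K ≐ 𝐄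
  Φ-proper coherent Φ≐𝐄 with Φ⁻ (proj₂ Φ≐𝐄 _ (𝐃̄[]∈𝐄 ∅))
  ... | W , W⊆K , e =
    IsCoherentSDS.K1 coherent (coherent⇒entailment-closed coherent W ∅ W⊆K (proj₂ e))

  module _ {𝓕 W₀} (𝓕≐↑ : 𝓕 ≐ ↑ W₀) where

    Δ⁻ : ∀ {S} → S ∈ Δ 𝓕 → E W₀ ⊆ 𝐃̄[ S ]
    Δ⁻ S∈Δ = proj₂ (↑⁻ (proj₁ 𝓕≐↑ _ S∈Δ))

    Δ⁺ : ∀ {S} → E W₀ ⊆ 𝐃̄[ S ] → S ∈ Δ 𝓕
    Δ⁺ E⊆ = proj₂ 𝓕≐↑ _ (↑⁺ (𝐃̄[]∈𝐄 _) E⊆)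

    Φ∘Δ : Φ (Δ 𝓕) ≐ 𝓕
    Φ∘Δ = (λ X x → let (W , W⊆Δ , X≐EW) = Φ⁻ x in
                     proj₂ 𝓕≐↑ X (↑⁺ (𝐄⁺ W X≐EW)
                       (⊆-trans (E-generators λ S S∈W → Δ⁻ (W⊆Δ S S∈W)) (proj₂ X≐EW))))
        , λ X x → let (W , X≐EW , entailed) = ↑⁻-generators (proj₁ 𝓕≐↑ X x) in
                  Φ⁺ W (λ S S∈W → Δ⁺ (entailed S S∈W)) X≐EW

    Δ-coherent : ¬ 𝓕 ≐ 𝐄 → IsCoherentSDS (Δ 𝓕)
    Δ-coherent proper = record
      { K1 = λ ∅∈Δ → proper (𝓕⊆𝐄 , λ X X∈𝐄 → proj₂ 𝓕≐↑ X (↑⁺ X∈𝐄 (E⊆everything ∅∈Δ)))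
      ; K2 = λ S₁ S₂ S₁∈Δ S₁⊆S₂ → Δ⁺ (⊆-trans (Δ⁻ S₁∈Δ) (𝐃̄[]-mono S₁⊆S₂))
      ; K3 = λ S S∈Δ → Δ⁺ (⊆-trans (Δ⁻ S∈Δ) 𝐃̄[]⊆𝐃̄[∖T₋])
      ; K4 = λ t t∈T₊ → Δ⁺ (⊆-trans E⊆𝐃̄ (𝐃̄⊆𝐃̄[] (⟪⟫⁺ (_≡ t) refl) t∈T₊))
      ; K5 = λ W _ W⊆Δ tσ tσ∈cl →
               Δ⁺ (⊆-trans (E-generators λ S S∈W → Δ⁻ (W⊆Δ S S∈W)) (E⊆𝐃̄[range] tσ tσ∈cl))
      }
      where
        𝓕⊆𝐄 : 𝓕 ⊆ 𝐄
        𝓕⊆𝐄 X X∈𝓕 = proj₁ (↑⁻ (proj₁ 𝓕≐↑ X X∈𝓕))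
        E⊆everything : ∅ ∈ Δ 𝓕 → ∀ {X} → E W₀ ⊆ X
        E⊆everything ∅∈Δ D d = ⊥-elim (∉𝐃̄[∅] D (Δ⁻ ∅∈Δ D d))

  Δ-in𝐊 : ∀ {𝓕} → IsPrincipalFilter 𝓕 → In𝐊 (Δ 𝓕)
  Δ-in𝐊 {𝓕} (_ , 𝓕≐↑) with em {𝓕 ≐ 𝐄}
  ... | yes 𝓕≐𝐄 = inj₂ ((λ _ _ → refl) , λ S _ → proj₂ 𝓕≐𝐄 _ (𝐃̄[]∈𝐄 S))
  ... | no proper = inj₁ (Δ-coherent 𝓕≐↑ proper)

  Φ-K₊ : Φ K₊ ≐ ｛𝐃̄｝
  Φ-K₊ = (λ X x → let (W , W⊆K₊ , X≐EW) = Φ⁻ x in ⟪⟫⁺ (_≐ 𝐃̄) (≐-trans X≐EW (E-meeting-T₊ W⊆K₊)))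
       , λ X X≐𝐃̄ → Φ⁺ ∅ (λ _ ()) (≐-trans (⟪⟫⁻ (_≐ 𝐃̄) X≐𝐃̄) (≐-sym (E-meeting-T₊ λ _ ())))

  Φ-full : Φ full ≐ 𝐄
  Φ-full = (λ X x → let (W , _ , X≐EW) = Φ⁻ x in 𝐄⁺ W X≐EW)
         , λ X x → let (W , X≐EW) = 𝐄⁻ x in Φ⁺ W (λ _ _ → refl) X≐EW

  Δ-｛𝐃̄｝ : Δ ｛𝐃̄｝ ≐ K₊
  Δ-｛𝐃̄｝ = (λ S S∈Δ → let (_ , t , t∈S , t∈T₊) = 𝐃̄[]⁻ S (proj₂ (⟪⟫⁻ (_≐ 𝐃̄) S∈Δ) T₊ T₊∈𝐃̄)
                      in K₊⁺ t∈S t∈T₊)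
          , λ S S∈K₊ → let (_ , t∈S , t∈T₊) = K₊⁻ S∈K₊ in ⟪⟫⁺ (_≐ 𝐃̄) (𝐃̄[]⊆𝐃̄ , 𝐃̄⊆𝐃̄[] t∈S t∈T₊)

  Δ-𝐄 : Δ 𝐄 ≐ full
  Δ-𝐄 = (λ _ _ → refl) , λ S _ → 𝐃̄[]∈𝐄 S

theorem8 : (em : ExcludedMiddle 0ℓ) (T : Set) → NonEmpty {T} full →
    (cl : (T → Bool) → (T → Bool)) → IsClosure cl →
    (T₋ : T → Bool) → (cl ∅ ∩ T₋) ≐ ∅ →
    Theory.Theorem8 em T cl T₋
theorem8 em T _ cl isClosure T₋ T₊∩T₋≐∅ =
    (λ K coherent → (K , Φ≐↑ (coherent⇒entailment-closed coherent)) , Φ-proper coherent)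
  , (λ 𝓕 ((_ , 𝓕≐↑) , proper) → Δ-coherent 𝓕≐↑ proper)
  , (λ K coherent → Δ∘Φ (coherent⇒entailment-closed coherent))
  , (λ 𝓕 ((_ , 𝓕≐↑) , _) → Φ∘Δ 𝓕≐↑)
  , (λ _ _ → Φ-mono)
  , (λ _ _ → Δ-mono)
  , (Φ-K₊ , Φ-full)
  , (Δ-｛𝐃̄｝ , Δ-𝐄)
  , (λ K K∈𝐊 → K , Φ≐↑ (𝐊⇒entailment-closed K∈𝐊))
  , (λ 𝓕 → Δ-in𝐊)
  , (λ K K∈𝐊 → Δ∘Φ (𝐊⇒entailment-closed K∈𝐊))
  , (λ 𝓕 (_ , 𝓕≐↑) → Φ∘Δ 𝓕≐↑)
  , (λ K₁ K₂ K₁∈𝐊 K₂∈𝐊 →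
      Φ-mono , Φ-reflects-⊆ (𝐊⇒entailment-closed K₁∈𝐊) (𝐊⇒entailment-closed K₂∈𝐊))
  where open SDSFilterCorrespondence em T cl isClosure T₋ T₊∩T₋≐∅
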